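{- Ordinal addition on $\mathrm{MutualOrd}$ is associative: for all $a, b, c : \mathrm{MutualOrd}$, $a + (b + c) \equiv (a + b) + c$.
   Context: Work in cubical type theory (as implemented in cubical Agda); $x \equiv y$ denotes the path type, $A \uplus B$ the coproduct. $\mathrm{MutualOrd} : \mathrm{Type}_0$ is defined simultaneously (inductive-inductive-recursively) with a relation $<$ on it and a function $\mathrm{fst} : \mathrm{MutualOrd} \to \mathrm{MutualOrd}$: its constructors are $\mathbf{0}$ and, for $a, b : \mathrm{MutualOrd}$ and $r : a \geq \mathrm{fst}(b)$, an element $\omega^a + b\,[r]$, where $a \geq b := (b < a) \uplus (a \equiv b)$. The relation $<$ is generated by: $\mathbf{0} < \omega^a + b\,[r]$; if $a < c$ then $\omega^a + b\,[r] < \omega^c + d\,[s]$; if $a \equiv c$ and $b < d$ then $\omega^a + b\,[r] < \omega^c + d\,[s]$. Finally $\mathrm{fst}(\mathbf{0}) = \mathbf{0}$ and $\mathrm{fst}(\omega^a + b\,[r]) = a$. For all $a,b$ one has $(a<b) \uplus (a \geq b)$ (trichotomy), and the two cases are mutually exclusive. Addition $+ : \mathrm{MutualOrd} \to \mathrm{MutualOrd} \to \mathrm{MutualOrd}$ is defined by $\mathbf{0} + b = b$; $a + \mathbf{0} = a$; and $(\omega^a + c\,[r]) + (\omega^b + d\,[s])$ equals $\omega^b + d\,[s]$ if $a < b$, and equals $\omega^a + \big(c + (\omega^b + d\,[s])\big)\,[t]$ if $a \geq b$, where $t$ is a witness of $a \geq \mathrm{fst}\big(c + (\omega^b + d\,[s])\big)$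 (defined simultaneously with $+$; such a witness always exists, and since $<$ is proposition-valued the resulting element does not depend on the choice of witness up to a path). -}

module Defs where

-- MutualOrd: ordinal notations below ε₀ in Cantor normal form, defined
-- inductive-inductive-recursively together with _<_ and fst
-- (Nordvall Forsberg, Xu, Ghani).

open import Data.Sum using (_⊎_; inj₁; inj₂)
open import Data.Empty using (⊥; ⊥-elim)
open import Relation.Nullary using (¬_)
open import Relation.Binary.PropositionalEquality using (_≡_; refl; cong; cong₂)

infix 30 _<_ _≥_
infixl 35 _+_

data MutualOrd : Set
data _<_ : MutualOrd → MutualOrd → Set
fst : MutualOrd → MutualOrd

_≥_ : MutualOrd → MutualOrd → Set
a ≥ b = (b < a) ⊎ (a ≡ b)

data MutualOrd where
  𝟎 : MutualOrd
  ω^_+_[_] : (a b : MutualOrd) → a ≥ fst b → MutualOrd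

private
  variable
    a b c d : MutualOrd
    r : a ≥ fst b
    s : c ≥ fst d

data _<_ where
  <₁ : 𝟎 < ω^ a + b [ r ]
  <₂ : a < c → ω^ a + b [ r ] < ω^ c + d [ s ]
  <₃ : a ≡ c → b < d → ω^ a + b [ r ] < ω^ c + d [ s ]

fst 𝟎 = 𝟎
fst (ω^ a + _ [ _ ]) = a

<-irrefl : ¬ (a < a)
<-irrefl (<₂ p) = <-irrefl p
<-irrefl (<₃ _ p) = <-irrefl p

<-prop : (p q : a < b) → p ≡ q
<-prop <₁ <₁ = refl
<-prop (<₂ p) (<₂ q) = cong <₂ (<-prop p q)
<-prop (<₂ p) (<₃ refl q) = ⊥-elim (<-irrefl p)
<-prop (<₃ refl p) (<₂ q) = ⊥-elim (<-irrefl q)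
<-prop (<₃ refl p) (<₃ refl q) = cong (<₃ refl) (<-prop p q)

≥-prop : (p q : a ≥ b) → p ≡ q
≥-prop (inj₁ p) (inj₁ q) = cong inj₁ (<-prop p q)
≥-prop (inj₁ p) (inj₂ refl) = ⊥-elim (<-irrefl p)
≥-prop (inj₂ refl) (inj₁ q) = ⊥-elim (<-irrefl q)
≥-prop (inj₂ refl) (inj₂ refl) = refl

<-tri : (a b : MutualOrd) → (a < b) ⊎ (a ≥ b)
<-tri 𝟎 𝟎 = inj₂ (inj₂ refl)
<-tri 𝟎 (ω^ _ + _ [ _ ]) = inj₁ <₁
<-tri (ω^ _ + _ [ _ ]) 𝟎 = inj₂ (inj₁ <₁)
<-tri (ω^ a + b [ r ]) (ω^ c + d [ s ]) with <-tri a c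
... | inj₁ a<c = inj₁ (<₂ a<c)
... | inj₂ (inj₁ c<a) = inj₂ (inj₁ (<₂ c<a))
... | inj₂ (inj₂ refl) with <-tri b d
...   | inj₁ b<d = inj₁ (<₃ refl b<d)
...   | inj₂ (inj₁ d<b) = inj₂ (inj₁ (<₃ refl d<b))
...   | inj₂ (inj₂ refl) = inj₂ (inj₂ (cong (ω^ a + b [_]) (≥-prop r s)))

_+_ : MutualOrd → MutualOrd → MutualOrd
+-≥fst : (a b d : MutualOrd) (s : b ≥ fst d) (c : MutualOrd) →
         a ≥ fst c → a ≥ b → a ≥ fst (c + ω^ b + d [ s ])

𝟎 + b = b
a@(ω^ _ + _ [ _ ]) + 𝟎 = a
(ω^ a + c [ r ]) + (ω^ b + d [ s ]) with <-tri a b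
... | inj₁ a<b = ω^ b + d [ s ]
... | inj₂ a≥b = ω^ a + (c + ω^ b + d [ s ]) [ +-≥fst a b d s c r a≥b ]

+-≥fst a b d s 𝟎 r a≥b = a≥b
+-≥fst a b d s (ω^ x + y [ t ]) r a≥b with <-tri x b
... | inj₁ _ = a≥b
... | inj₂ _ = r

module Submission where

-- Adding a term A = ω^a + c [ r ] to an arbitrary X is governed by how a
-- compares with the leading exponent fst X:
--   * if a < fst X, then A is absorbed:       A + X ≡ X             (+-absorb)
--   * if a ≥ fst X, then X is pushed inward:  A + X ≡ ω^a + (c + X)  (+-unfold)
-- Both hold for every X, including 𝟎, so the special cases of the defining
-- equations disappear.  We also need that the leading exponent of X + Y lies
-- above fst X (fst-+-≥ˡ) and below every common upper bound of fst X and
-- fst Y (fst-+-lub).  Associativity A + (X + Y) ≡ (A + X) + Y then follows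
-- by induction on A, comparing a with fst X and fst Y: either A is absorbed
-- on both sides, or both sides unfold to ω^a + … and the induction
-- hypothesis for c closes the goal.

open import Defs
open import Data.Sum using (inj₁; inj₂)
open import Data.Empty using (⊥; ⊥-elim)
open import Relation.Binary.PropositionalEquality using (_≡_; refl; sym; cong; module ≡-Reasoning)
open ≡-Reasoning

private
  variable
    a b c : MutualOrd

<-trans : a < b → b < c → a < c
<-trans <₁ (<₂ _) = <₁
<-trans <₁ (<₃ _ _) = <₁
<-trans (<₂ p) (<₂ q) = <₂ (<-trans p q)
<-trans (<₂ p) (<₃ refl _) = <₂ p
<-trans (<₃ refl _) (<₂ q) = <₂ q
<-trans (<₃ refl p) (<₃ refl q) = <₃ refl (<-trans p q)

≥-<-trans : a ≥ b → a < c → b < c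
≥-<-trans (inj₁ b<a) a<c = <-trans b<a a<c
≥-<-trans (inj₂ refl) a<c = a<c

<-≥-trans : a < b → c ≥ b → a < c
<-≥-trans a<b (inj₁ b<c) = <-trans a<b b<c
<-≥-trans a<b (inj₂ refl) = a<b

<-≱ : a < b → a ≥ b → ⊥
<-≱ a<b a≥b = <-irrefl (<-≥-trans a<b a≥b)

≥𝟎 : a ≥ 𝟎
≥𝟎 {𝟎} = inj₂ refl
≥𝟎 {ω^ _ + _ [ _ ]} = inj₁ <₁

-- Terms are determined by exponent and tail, since ≥ is proposition-valued.
ω-cong : ∀ {a a' b b'} {r : a ≥ fst b} {r' : a' ≥ fst b'} →
         a ≡ a' → b ≡ b' → ω^ a + b [ r ] ≡ ω^ a' + b' [ r' ]
ω-cong {a} {_} {b} refl refl = cong (ω^ a + b [_]) (≥-prop _ _)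

+-identityʳ : (X : MutualOrd) → X + 𝟎 ≡ X
+-identityʳ 𝟎 = refl
+-identityʳ (ω^ _ + _ [ _ ]) = refl

fst-+-≥ˡ : (X Y : MutualOrd) → fst (X + Y) ≥ fst X
fst-+-≥ˡ 𝟎 Y = ≥𝟎
fst-+-≥ˡ (ω^ _ + _ [ _ ]) 𝟎 = inj₂ refl
fst-+-≥ˡ (ω^ x + _ [ _ ]) (ω^ y + _ [ _ ]) with <-tri x y
... | inj₁ x<y = inj₁ x<y
... | inj₂ _ = inj₂ refl

fst-+-lub : (X Y : MutualOrd) → a ≥ fst X → a ≥ fst Y → a ≥ fst (X + Y)
fst-+-lub 𝟎 _ _ a≥Y = a≥Y
fst-+-lub (ω^ _ + _ [ _ ]) 𝟎 a≥X _ = a≥X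
fst-+-lub (ω^ x + _ [ _ ]) (ω^ y + _ [ _ ]) a≥X a≥Y with <-tri x y
... | inj₁ _ = a≥Y
... | inj₂ _ = a≥X

+-absorb : (X Y : MutualOrd) → fst X < fst Y → X + Y ≡ Y
+-absorb 𝟎 _ _ = refl
+-absorb (ω^ _ + _ [ _ ]) 𝟎 ()
+-absorb (ω^ x + _ [ _ ]) (ω^ y + _ [ _ ]) x<y with <-tri x y
... | inj₁ _ = refl
... | inj₂ x≥y = ⊥-elim (<-≱ x<y x≥y)

+-unfold : (a c : MutualOrd) (r : a ≥ fst c) (X : MutualOrd) (a≥X : a ≥ fst X) →
           ω^ a + c [ r ] + X ≡ ω^ a + (c + X) [ fst-+-lub c X r a≥X ]
+-unfold _ c _ 𝟎 _ = ω-cong refl (sym (+-identityʳ c))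
+-unfold a _ _ (ω^ x + _ [ _ ]) a≥x with <-tri a x
... | inj₁ a<x = ⊥-elim (<-≱ a<x a≥x)
... | inj₂ _ = ω-cong refl refl

mainTheorem12 : (a b c : MutualOrd) → a + (b + c) ≡ (a + b) + c
mainTheorem12 𝟎 X Y = refl
mainTheorem12 A@(ω^ a + c [ r ]) X Y with <-tri a (fst X)
... | inj₁ a<X = begin
  A + (X + Y)  ≡⟨ +-absorb A (X + Y) (<-≥-trans a<X (fst-+-≥ˡ X Y)) ⟩
  X + Y        ≡⟨ cong (_+ Y) (sym (+-absorb A X a<X)) ⟩
  (A + X) + Y  ∎
... | inj₂ a≥X with <-tri a (fst Y)
...   | inj₁ a<Y = begin
  A + (X + Y)  ≡⟨ cong (A +_) (+-absorb X Y (≥-<-trans a≥X a<Y)) ⟩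
  A + Y        ≡⟨ +-absorb A Y a<Y ⟩
  Y            ≡⟨ sym (+-absorb A+X Y a<Y) ⟩
  A+X + Y      ≡⟨ cong (_+ Y) (sym (+-unfold a c r X a≥X)) ⟩
  (A + X) + Y  ∎
  where
  A+X : MutualOrd
  A+X = ω^ a + (c + X) [ fst-+-lub c X r a≥X ]
...   | inj₂ a≥Y = begin
  A + (X + Y)                ≡⟨ +-unfold a c r (X + Y) (fst-+-lub X Y a≥X a≥Y) ⟩
  ω^ a + (c + (X + Y)) [ _ ]  ≡⟨ ω-cong refl (mainTheorem12 c X Y) ⟩
  ω^ a + ((c + X) + Y) [ _ ]  ≡⟨ sym (+-unfold a (c + X) _ Y a≥Y) ⟩
  A+X + Y                    ≡⟨ cong (_+ Y) (sym (+-unfold a c r X a≥X)) ⟩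
  (A + X) + Y                ∎
  where
  A+X : MutualOrd
  A+X = ω^ a + (c + X) [ fst-+-lub c X r a≥X ]
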